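{- Let $Q=P_1+\cdots+P_r$ be a concatenation of pieces, each simple with respect to $k$, with $\pi^+_{P_i}=\pi^-_{P_{i+1}}$ for all $i$ and $\pi^-_{P_1}=\mathrm{id}$. Then $Q$, viewed as a generalized wiring diagram, is reduced and simple with respect to $k$.
   Context: A generalized wiring diagram has countably many wires labeled $1,2,3,\dots$, wire $i$ initially at level $i$, and a finite sequence of steps; each step is either a crossing of the wires at adjacent levels $h,h+1$ (intersection at level $h$) or a fall of the wire at some level $h$ (it is removed, intersects each wire below it, the intersection with the wire at level $h+j$ counting at level $h+j-1$, and the wires below move up one level). Reduced: no pair of wires intersects more than once. Simple with respect to $k$: reduced and there is no (S1) pair of wires $a<b$ intersecting at a level other than $k$ at a moment when wires $a+1,\dots,b-1$ have all fallen, and no (S2) wire $a$ intersecting $k$ wires with larger labels (not counting intersections created when $a$ falls). For a diagram $W$ and time $t$, if $a_1<a_2<\cdots$ are the labels of non-fallen wires after step $t$, $\pi^{(t)}_W$ is the permutation with wire $a_{\pi^{(t)}_W(h)}$ at level $h$; $\pi^{(0)}_W=\mathrm{id}$. A piece $P$ is the single step of a diagram $W$ at some time $t$ together with $\pi^-_P=\pi^{(t-1)}_W$, $\pi^+_P=\pi^{(t)}_W$; it is simple with respect to $k$ if it arises from some simple reduced diagram $W$. Pieces with $\pi^+_{P_i}=\pi^-_{P_{i+1}}$ are concatenated by drawing them one after another. -}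

module Defs where

open import Data.Nat using (ℕ; zero; suc; _+_; _∸_; _≤_; _<_; _<ᵇ_; _≟_; _≤?_)
open import Data.Bool using (Bool; true; false; if_then_else_)
open import Data.List using (List; []; _∷_; length; filter; upTo; take; map)
open import Data.List.Membership.Propositional using (_∈_; _∉_)
open import Data.List.Membership.DecPropositional _≟_ using (_∈?_)
open import Data.List.Relation.Unary.All using (All)
open import Data.List.Relation.Unary.Unique.Propositional using (Unique)
open import Data.Maybe using (Maybe; just; nothing)
open import Data.Product using (Σ; ∃; ∃-syntax; _×_; _,_)
open import Data.Sum using (_⊎_)
open import Data.Unit using (⊤)
open import Relation.Nullary using (¬_; ¬?)
open import Relation.Nullary.Decidable using (_×-dec_)
open import Relation.Binary.PropositionalEquality using (_≡_)

-- Conventions: levels and wire labels are 1-indexed exactly as in the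
-- paper (level 1 is the top level, wire i starts at level i).  Value 0
-- is never a level or a label; whatever a function does at 0 is junk
-- and is never inspected.

-- A step: a crossing at level h (of the wires at levels h, h+1),
-- or the fall of the wire at level h.
data Step : Set where
  cross : ℕ → Step
  fall  : ℕ → Step

stepLevel : Step → ℕ
stepLevel (cross h) = h
stepLevel (fall h)  = h

Diagram : Set
Diagram = List Step

WellFormed : Diagram → Set
WellFormed W = All (λ s → 1 ≤ stepLevel s) W

record Config : Set where
  constructor config
  field
    wireAt : ℕ → ℕ
    fallen : List ℕ
open Config public

initConfig : Config
initConfig = config (λ h → h) []

swapAt : ℕ → (ℕ → ℕ) → ℕ → ℕ
swapAt h f n with n ≟ h | n ≟ suc h
... | Relation.Nullary.yes _ | _ = f (suc h)
... | Relation.Nullary.no _ | Relation.Nullary.yes _ = f h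
... | Relation.Nullary.no _ | Relation.Nullary.no _ = f n

applyStep : Config → Step → Config
applyStep (config f fl) (cross h) = config (swapAt h f) fl
applyStep (config f fl) (fall h)  =
  config (λ n → if n <ᵇ h then f n else f (suc n)) (f h ∷ fl)

run : Config → Diagram → Config
run c []       = c
run c (s ∷ ws) = run (applyStep c s) ws

configAfter : Diagram → ℕ → Config
configAfter W t = run initConfig (take t W)

-- the step at (0-indexed) position i, i.e. the (i+1)-st step
stepAt : Diagram → ℕ → Maybe Step
stepAt []       _       = nothing
stepAt (s ∷ ws) zero    = just s
stepAt (s ∷ ws) (suc i) = stepAt ws i

-- Intersections.  StepMeets f s x y l : during step s, performed from
-- the level assignment f, wire x (upper) and wire y (lower) intersect,
-- the intersection counting at level l.

data StepMeets (f : ℕ → ℕ) : Step → ℕ → ℕ → ℕ → Set where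
  crossMeet : ∀ {h x y} → f h ≡ x → f (suc h) ≡ y → StepMeets f (cross h) x y h
  fallMeet  : ∀ {h x y} (j : ℕ) → f h ≡ x → f (h + suc j) ≡ y →
              StepMeets f (fall h) x y (h + j)

IntersectAt : Diagram → ℕ → ℕ → ℕ → ℕ → Set
IntersectAt W i a b l =
  Σ Step λ s → stepAt W i ≡ just s ×
    (StepMeets (wireAt (configAfter W i)) s a b l
     ⊎ StepMeets (wireAt (configAfter W i)) s b a l)

Reduced : Diagram → Set
Reduced W = ∀ a b i j l m → IntersectAt W i a b l → IntersectAt W j a b m → i ≡ j

ViolatesS1 : ℕ → Diagram → Set
ViolatesS1 k W =
  ∃[ a ] ∃[ b ] ∃[ i ] ∃[ l ]
    (a < b × IntersectAt W i a b l × ¬ (l ≡ k) ×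
     (∀ c → a < c → c < b → c ∈ fallen (configAfter W i)))

FallsAt : Diagram → ℕ → ℕ → Set
FallsAt W i a = ∃[ h ] (stepAt W i ≡ just (fall h) × wireAt (configAfter W i) h ≡ a)

MeetsNotAtFall : Diagram → ℕ → ℕ → Set
MeetsNotAtFall W a b = ∃[ i ] ∃[ l ] (IntersectAt W i a b l × ¬ FallsAt W i a)

ViolatesS2 : ℕ → Diagram → Set
ViolatesS2 k W =
  ∃[ a ] Σ (List ℕ) λ bs →
    length bs ≡ k × Unique bs × All (λ b → a < b × MeetsNotAtFall W a b) bs

Simple : ℕ → Diagram → Set
Simple k W = WellFormed W × Reduced W × ¬ ViolatesS1 k W × ¬ ViolatesS2 k W

-- The permutation π^{(t)}_W : if a₁ < a₂ < ⋯ are the labels of the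
-- non-fallen wires, π(h) is the index n with a_n = wire at level h,
-- i.e. 1 + #{ non-fallen labels y : 1 ≤ y < wire at level h }.

rankAmongAlive : List ℕ → ℕ → ℕ
rankAmongAlive fl x =
  suc (length (filter (λ y → (1 ≤? y) ×-dec ¬? (y ∈? fl)) (upTo x)))

perm : Config → ℕ → ℕ
perm c h = rankAmongAlive (fallen c) (wireAt c h)

permAfter : Diagram → ℕ → ℕ → ℕ
permAfter W t = perm (configAfter W t)

_≈ₚ_ : (ℕ → ℕ) → (ℕ → ℕ) → Set
π ≈ₚ σ = ∀ h → 1 ≤ h → π h ≡ σ h

IsId : (ℕ → ℕ) → Set
IsId π = π ≈ₚ (λ h → h)

record Piece : Set where
  constructor piece
  field
    pstep : Step
    π⁻    : ℕ → ℕ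
    π⁺    : ℕ → ℕ
open Piece public

-- P is the step of W at time t = i+1 (0-indexed position i), with
-- π⁻ = π^{(t-1)}_W and π⁺ = π^{(t)}_W.
PieceOf : Piece → Diagram → ℕ → Set
PieceOf P W i =
  stepAt W i ≡ just (pstep P) ×
  π⁻ P ≈ₚ permAfter W i × π⁺ P ≈ₚ permAfter W (suc i)

SimplePiece : ℕ → Piece → Set
SimplePiece k P = ∃[ W ] ∃[ i ] (Simple k W × PieceOf P W i)

Chained : List Piece → Set
Chained []           = ⊤
Chained (P ∷ [])     = ⊤
Chained (P ∷ P' ∷ Ps) = (π⁺ P ≈ₚ π⁻ P') × Chained (P' ∷ Ps)

StartsAtId : List Piece → Set
StartsAtId []      = ⊤
StartsAtId (P ∷ _) = IsId (π⁻ P)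

concatPieces : List Piece → Diagram
concatPieces Ps = map pstep Ps

-- The permutation π⁽ᵗ⁾ records, for the wires at any two levels, which label is smaller and whether
-- every label strictly between them has fallen; and π⁽ᵗ⁾ is a function of π⁽ᵗ⁻¹⁾ and the t-th step.
-- Hence, along the concatenation Q, the permutation before each step is π⁻ of its piece, which is the
-- permutation before the same step in the simple diagram W the piece comes from.  In a reduced diagram
-- every meeting has the smaller label on top (an inversion can only be created by a meeting), and this
-- transfers from W to Q; conversely it forces Q to be reduced, because once x < y have met, x has
-- fallen or lies below y.  (S1) transfers directly.  For (S2): after the latest meeting of a with the k
-- wires, they all lie above a; after the same step W has the same inversions, so a's counterpart in W
-- met k wires with larger labels.

module Submission where

open import Defs
open import Data.Nat using (ℕ; zero; suc; _+_; _∸_; _≤_; _<_; _<ᵇ_; _≟_; _≤?_; _<?_; z≤n; s≤s; z<s; pred)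
open import Data.Nat.Properties
open import Data.Bool using (true; false; if_then_else_)
open import Data.Bool.Properties using (if-float)
open import Data.Maybe using (Maybe; just; nothing)
open import Data.List using (List; []; _∷_; _++_; length; filter; upTo; take; map; [_])
open import Data.List.Properties using (length-++; length-map; filter-++; upTo-∷ʳ; filter-accept; filter-reject)
open import Data.List.Membership.Propositional using (_∈_; _∉_)
open import Data.List.Membership.DecPropositional _≟_ using (_∈?_)
open import Data.List.Relation.Unary.Any using (here; there)
open import Data.List.Relation.Unary.All using (All; []; _∷_)
import Data.List.Relation.Unary.All as All
import Data.List.Relation.Unary.All.Properties as All
open import Data.List.Relation.Unary.All.Properties using (take⁺)
open import Data.List.Relation.Unary.Unique.Propositional using (Unique)
import Data.List.Relation.Unary.Unique.Propositional.Properties as Unique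
open import Data.Product using (∃; ∃-syntax; _×_; _,_; proj₁; proj₂)
open import Data.Sum using (_⊎_; inj₁; inj₂)
open import Data.Empty using (⊥-elim)
open import Data.Unit using (tt)
open import Function using (_∘_)
open import Relation.Nullary using (¬_; ¬?; yes; no; Dec)
open import Relation.Nullary.Decidable using (_×-dec_)
open import Relation.Binary using (tri<; tri≈; tri>)
open import Relation.Binary.PropositionalEquality
  using (_≡_; _≢_; ≢-sym; refl; sym; trans; cong; cong₂; subst; subst₂; module ≡-Reasoning)

Alive : List ℕ → ℕ → Set
Alive fl y = 1 ≤ y × y ∉ fl

alive? : (fl : List ℕ) → (y : ℕ) → Dec (Alive fl y)
alive? fl y = (1 ≤? y) ×-dec ¬? (y ∈? fl)

-- perm c h ≡ suc (aliveBelow (fallen c) (wireAt c h)) holds definitionally.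
aliveBelow : List ℕ → ℕ → ℕ
aliveBelow fl n = length (filter (alive? fl) (upTo n))

aliveIndicator : List ℕ → ℕ → ℕ
aliveIndicator fl n = length (filter (alive? fl) [ n ])

aliveBelow-suc : ∀ fl n → aliveBelow fl (suc n) ≡ aliveBelow fl n + aliveIndicator fl n
aliveBelow-suc fl n = begin
  length (filter (alive? fl) (upTo (suc n)))
    ≡⟨ cong (length ∘ filter (alive? fl)) (sym (upTo-∷ʳ n)) ⟩
  length (filter (alive? fl) (upTo n ++ [ n ]))
    ≡⟨ cong length (filter-++ (alive? fl) (upTo n) [ n ]) ⟩
  length (filter (alive? fl) (upTo n) ++ filter (alive? fl) [ n ])
    ≡⟨ length-++ (filter (alive? fl) (upTo n)) ⟩
  aliveBelow fl n + aliveIndicator fl n ∎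
  where open ≡-Reasoning

aliveIndicator-cong : ∀ {fl fl′} n → (Alive fl n → Alive fl′ n) → (Alive fl′ n → Alive fl n) →
                      aliveIndicator fl n ≡ aliveIndicator fl′ n
aliveIndicator-cong {fl} {fl′} n to from with alive? fl n
... | yes a  = trans (cong length (filter-accept (alive? fl) {xs = []} a))
                     (sym (cong length (filter-accept (alive? fl′) {xs = []} (to a))))
... | no ¬a  = trans (cong length (filter-reject (alive? fl) {xs = []} ¬a))
                     (sym (cong length (filter-reject (alive? fl′) {xs = []} (¬a ∘ from))))

aliveBelow-suc-alive : ∀ fl n → Alive fl n → aliveBelow fl (suc n) ≡ suc (aliveBelow fl n)
aliveBelow-suc-alive fl n a = begin
  aliveBelow fl (suc n)                 ≡⟨ aliveBelow-suc fl n ⟩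
  aliveBelow fl n + aliveIndicator fl n ≡⟨ cong (aliveBelow fl n +_) (cong length (filter-accept (alive? fl) {xs = []} a)) ⟩
  aliveBelow fl n + 1                   ≡⟨ +-comm (aliveBelow fl n) 1 ⟩
  suc (aliveBelow fl n)                 ∎
  where open ≡-Reasoning

aliveBelow-suc-dead : ∀ fl n → ¬ Alive fl n → aliveBelow fl (suc n) ≡ aliveBelow fl n
aliveBelow-suc-dead fl n ¬a = begin
  aliveBelow fl (suc n)                 ≡⟨ aliveBelow-suc fl n ⟩
  aliveBelow fl n + aliveIndicator fl n ≡⟨ cong (aliveBelow fl n +_) (cong length (filter-reject (alive? fl) {xs = []} ¬a)) ⟩
  aliveBelow fl n + 0                   ≡⟨ +-identityʳ (aliveBelow fl n) ⟩
  aliveBelow fl n                       ∎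
  where open ≡-Reasoning

aliveBelow-mono-≤ : ∀ fl {m n} → m ≤ n → aliveBelow fl m ≤ aliveBelow fl n
aliveBelow-mono-≤ fl {n = zero}  z≤n  = ≤-refl
aliveBelow-mono-≤ fl {n = suc n} m≤1+n with m≤n⇒m<n∨m≡n m≤1+n
... | inj₂ refl = ≤-refl
... | inj₁ m<1+n = ≤-trans (aliveBelow-mono-≤ fl (m<1+n⇒m≤n m<1+n))
                           (≤-trans (m≤m+n _ _) (≤-reflexive (sym (aliveBelow-suc fl n))))

aliveBelow-mono-< : ∀ fl {x y} → Alive fl x → x < y → aliveBelow fl x < aliveBelow fl y
aliveBelow-mono-< fl {x} a x<y =
  ≤-trans (≤-reflexive (sym (aliveBelow-suc-alive fl x a))) (aliveBelow-mono-≤ fl x<y)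

aliveBelow-cancel-< : ∀ fl {x y} → Alive fl y → aliveBelow fl x < aliveBelow fl y → x < y
aliveBelow-cancel-< fl {x} {y} ay lt with <-cmp x y
... | tri< x<y _ _ = x<y
... | tri≈ _ refl _ = ⊥-elim (<-irrefl refl lt)
... | tri> _ _ y<x = ⊥-elim (<-asym lt (aliveBelow-mono-< fl ay y<x))

consecutive⇒between-fallen : ∀ fl {x y} → Alive fl x → aliveBelow fl y ≡ suc (aliveBelow fl x) →
                             ∀ c → x < c → c < y → c ∈ fl
consecutive⇒between-fallen fl {x} {y} ax eq c x<c c<y with c ∈? fl
... | yes c∈fl = c∈fl
... | no  c∉fl = ⊥-elim (<-irrefl (sym eq) (≤-<-trans (aliveBelow-mono-< fl ax x<c)
                                                (aliveBelow-mono-< fl (≤-trans (s≤s z≤n) x<c , c∉fl) c<y)))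

between-fallen⇒consecutive : ∀ fl {x} → Alive fl x → ∀ y → x < y → (∀ c → x < c → c < y → c ∈ fl) →
                             aliveBelow fl y ≡ suc (aliveBelow fl x)
between-fallen⇒consecutive fl {x} ax (suc y) x<1+y between with m<1+n⇒m<n∨m≡n x<1+y
... | inj₂ refl = aliveBelow-suc-alive fl x ax
... | inj₁ x<y  = trans (aliveBelow-suc-dead fl y (λ ay → proj₂ ay (between y x<y ≤-refl)))
                        (between-fallen⇒consecutive fl ax y x<y (λ c x<c c<y → between c x<c (m<n⇒m<1+n c<y)))

aliveBelow-initial : ∀ n → aliveBelow [] (suc n) ≡ n
aliveBelow-initial zero    = aliveBelow-suc-dead [] zero (λ { (() , _) })
aliveBelow-initial (suc n) = trans (aliveBelow-suc-alive [] (suc n) (s≤s z≤n , λ ())) (cong suc (aliveBelow-initial n))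

module _ (fl : List ℕ) {x : ℕ} (ax : Alive fl x) where

  private
    indicator-fall : ∀ {m} → m ≢ x → aliveIndicator (x ∷ fl) m ≡ aliveIndicator fl m
    indicator-fall {m} m≢x =
      aliveIndicator-cong m (λ (1≤m , m∉) → 1≤m , m∉ ∘ there) (λ (1≤m , m∉fl) → 1≤m , still-alive m∉fl)
      where
      still-alive : m ∉ fl → m ∉ x ∷ fl
      still-alive m∉fl (here m≡x)   = m≢x m≡x
      still-alive m∉fl (there m∈fl) = m∉fl m∈fl

  aliveBelow-fall-≤ : ∀ n → n ≤ x → aliveBelow (x ∷ fl) n ≡ aliveBelow fl n
  aliveBelow-fall-≤ zero    _   = refl
  aliveBelow-fall-≤ (suc n) n<x = begin
    aliveBelow (x ∷ fl) (suc n)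
      ≡⟨ aliveBelow-suc (x ∷ fl) n ⟩
    aliveBelow (x ∷ fl) n + aliveIndicator (x ∷ fl) n
      ≡⟨ cong₂ _+_ (aliveBelow-fall-≤ n (<⇒≤ n<x)) (indicator-fall (<⇒≢ n<x)) ⟩
    aliveBelow fl n + aliveIndicator fl n
      ≡⟨ sym (aliveBelow-suc fl n) ⟩
    aliveBelow fl (suc n) ∎
    where open ≡-Reasoning

  aliveBelow-fall-> : ∀ n → x < n → suc (aliveBelow (x ∷ fl) n) ≡ aliveBelow fl n
  aliveBelow-fall-> (suc n) x<1+n with m<1+n⇒m<n∨m≡n x<1+n
  ... | inj₂ refl = begin
    suc (aliveBelow (x ∷ fl) (suc x)) ≡⟨ cong suc (aliveBelow-suc-dead (x ∷ fl) x (λ a → proj₂ a (here refl))) ⟩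
    suc (aliveBelow (x ∷ fl) x)       ≡⟨ cong suc (aliveBelow-fall-≤ x ≤-refl) ⟩
    suc (aliveBelow fl x)             ≡⟨ sym (aliveBelow-suc-alive fl x ax) ⟩
    aliveBelow fl (suc x)             ∎
    where open ≡-Reasoning
  ... | inj₁ x<n = begin
    suc (aliveBelow (x ∷ fl) (suc n))
      ≡⟨ cong suc (aliveBelow-suc (x ∷ fl) n) ⟩
    suc (aliveBelow (x ∷ fl) n + aliveIndicator (x ∷ fl) n)
      ≡⟨ cong₂ _+_ (aliveBelow-fall-> n x<n) (indicator-fall (≢-sym (<⇒≢ x<n))) ⟩
    aliveBelow fl n + aliveIndicator fl n
      ≡⟨ sym (aliveBelow-suc fl n) ⟩
    aliveBelow fl (suc n) ∎
    where open ≡-Reasoning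

swapLevel : ℕ → ℕ → ℕ
swapLevel h n with n ≟ h | n ≟ suc h
... | yes _ | _     = suc h
... | no _  | yes _ = h
... | no _  | no _  = n

swapAt≗swapLevel : ∀ h f n → swapAt h f n ≡ f (swapLevel h n)
swapAt≗swapLevel h f n with n ≟ h | n ≟ suc h
... | yes _ | _     = refl
... | no _  | yes _ = refl
... | no _  | no _  = refl

data SwapCase (h n : ℕ) : Set where
  upper : n ≡ h → SwapCase h n
  lower : n ≡ suc h → SwapCase h n
  other : n ≢ h → n ≢ suc h → SwapCase h n

swapCase : ∀ h n → SwapCase h n
swapCase h n with n ≟ h | n ≟ suc h
... | yes n≡h | _         = upper n≡h
... | no _    | yes n≡1+h = lower n≡1+h
... | no n≢h  | no n≢1+h  = other n≢h n≢1+h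

swapLevel-upper : ∀ h → swapLevel h h ≡ suc h
swapLevel-upper h with h ≟ h
... | yes _  = refl
... | no h≢h = ⊥-elim (h≢h refl)

swapLevel-lower : ∀ h → swapLevel h (suc h) ≡ h
swapLevel-lower h with suc h ≟ h | suc h ≟ suc h
... | yes 1+h≡h | _ = ⊥-elim (1+n≢n 1+h≡h)
... | no _ | yes _  = refl
... | no _ | no ne  = ⊥-elim (ne refl)

swapLevel-other : ∀ h n → n ≢ h → n ≢ suc h → swapLevel h n ≡ n
swapLevel-other h n n≢h n≢1+h with n ≟ h | n ≟ suc h
... | yes n≡h | _         = ⊥-elim (n≢h n≡h)
... | no _    | yes n≡1+h = ⊥-elim (n≢1+h n≡1+h)
... | no _    | no _      = refl

swapLevel-involutive : ∀ h n → swapLevel h (swapLevel h n) ≡ n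
swapLevel-involutive h n with swapCase h n
... | upper refl = trans (cong (swapLevel h) (swapLevel-upper h)) (swapLevel-lower h)
... | lower refl = trans (cong (swapLevel h) (swapLevel-lower h)) (swapLevel-upper h)
... | other n≢h n≢1+h = trans (cong (swapLevel h) (swapLevel-other h n n≢h n≢1+h)) (swapLevel-other h n n≢h n≢1+h)

swapLevel-positive : ∀ h n → 1 ≤ h → 1 ≤ n → 1 ≤ swapLevel h n
swapLevel-positive h n 1≤h 1≤n with swapCase h n
... | upper refl = subst (1 ≤_) (sym (swapLevel-upper h)) (s≤s z≤n)
... | lower refl = subst (1 ≤_) (sym (swapLevel-lower h)) 1≤h
... | other n≢h n≢1+h = subst (1 ≤_) (sym (swapLevel-other h n n≢h n≢1+h)) 1≤n

swapLevel-mono-< : ∀ h p q → p < q → ¬ (p ≡ h × q ≡ suc h) → swapLevel h p < swapLevel h q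
swapLevel-mono-< h p q p<q not-swapped with swapCase h p | swapCase h q
... | upper refl | upper refl = ⊥-elim (<-irrefl refl p<q)
... | upper refl | lower refl = ⊥-elim (not-swapped (refl , refl))
... | upper refl | other q≢h q≢1+h rewrite swapLevel-upper h | swapLevel-other h q q≢h q≢1+h = ≤∧≢⇒< p<q (≢-sym q≢1+h)
... | lower refl | upper refl = ⊥-elim (<-asym p<q (n<1+n h))
... | lower refl | lower refl = ⊥-elim (<-irrefl refl p<q)
... | lower refl | other q≢h q≢1+h rewrite swapLevel-lower h | swapLevel-other h q q≢h q≢1+h = <-trans (n<1+n h) p<q
... | other p≢h p≢1+h | upper refl rewrite swapLevel-upper h | swapLevel-other h p p≢h p≢1+h = <-trans p<q (n<1+n h)
... | other p≢h p≢1+h | lower refl rewrite swapLevel-lower h | swapLevel-other h p p≢h p≢1+h = ≤∧≢⇒< (≤-pred p<q) p≢h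
... | other p≢h p≢1+h | other q≢h q≢1+h rewrite swapLevel-other h p p≢h p≢1+h | swapLevel-other h q q≢h q≢1+h = p<q

if-<ᵇ-true : ∀ {A : Set} {m n} {u v : A} → m < n → (if m <ᵇ n then u else v) ≡ u
if-<ᵇ-true {m = m} {n} m<n with m <ᵇ n | <⇒<ᵇ m<n
... | true | _ = refl

if-<ᵇ-false : ∀ {A : Set} {m n} {u v : A} → n ≤ m → (if m <ᵇ n then u else v) ≡ v
if-<ᵇ-false {m = m} {n} n≤m with m <ᵇ n | <ᵇ⇒< m n
... | true  | m<n = ⊥-elim (<⇒≱ (m<n tt) n≤m)
... | false | _   = refl

-- After the wire at level h falls, the wire now at level n came from level skipLevel h n.
skipLevel : ℕ → ℕ → ℕ
skipLevel h n = if n <ᵇ h then n else suc n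

unskipLevel : ℕ → ℕ → ℕ
unskipLevel h n = if n <ᵇ h then n else pred n

skipLevel-< : ∀ h n → n < h → skipLevel h n ≡ n
skipLevel-< h n = if-<ᵇ-true

skipLevel-≥ : ∀ h n → h ≤ n → skipLevel h n ≡ suc n
skipLevel-≥ h n = if-<ᵇ-false

skipLevel-mono-< : ∀ h {p q} → p < q → skipLevel h p < skipLevel h q
skipLevel-mono-< h {p} {q} p<q with p <? h | q <? h
... | yes p<h | yes q<h rewrite skipLevel-< h p p<h | skipLevel-< h q q<h = p<q
... | yes p<h | no q≮h  rewrite skipLevel-< h p p<h | skipLevel-≥ h q (≮⇒≥ q≮h) = m<n⇒m<1+n p<q
... | no p≮h  | yes q<h = ⊥-elim (p≮h (<-trans p<q q<h))
... | no p≮h  | no q≮h  rewrite skipLevel-≥ h p (≮⇒≥ p≮h) | skipLevel-≥ h q (≮⇒≥ q≮h) = s≤s p<q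

skipLevel-injective : ∀ h {p q} → skipLevel h p ≡ skipLevel h q → p ≡ q
skipLevel-injective h {p} {q} eq with <-cmp p q
... | tri< p<q _ _ = ⊥-elim (<⇒≢ (skipLevel-mono-< h p<q) eq)
... | tri≈ _ p≡q _ = p≡q
... | tri> _ _ q<p = ⊥-elim (<⇒≢ (skipLevel-mono-< h q<p) (sym eq))

skipLevel-positive : ∀ h n → 1 ≤ n → 1 ≤ skipLevel h n
skipLevel-positive h n 1≤n with n <? h
... | yes n<h rewrite skipLevel-< h n n<h = 1≤n
... | no n≮h  rewrite skipLevel-≥ h n (≮⇒≥ n≮h) = s≤s z≤n

skipLevel-≢ : ∀ h n → skipLevel h n ≢ h
skipLevel-≢ h n with n <? h
... | yes n<h rewrite skipLevel-< h n n<h = <⇒≢ n<h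
... | no n≮h  rewrite skipLevel-≥ h n (≮⇒≥ n≮h) = ≢-sym (<⇒≢ (s≤s (≮⇒≥ n≮h)))

skipLevel-unskipLevel : ∀ h n → n ≢ h → skipLevel h (unskipLevel h n) ≡ n
skipLevel-unskipLevel h n n≢h with n <? h
... | yes n<h rewrite if-<ᵇ-true {u = n} {v = pred n} n<h = skipLevel-< h n n<h
skipLevel-unskipLevel h (suc n) n≢h | no n≮h
  rewrite if-<ᵇ-false {u = suc n} {v = n} (≮⇒≥ n≮h) = skipLevel-≥ h n (≤-pred (≤∧≢⇒< (≮⇒≥ n≮h) (≢-sym n≢h)))
skipLevel-unskipLevel h zero n≢h | no n≮h = ⊥-elim (n≢h (sym (n≤0⇒n≡0 (≮⇒≥ n≮h))))

unskipLevel-positive : ∀ h n → 1 ≤ h → 1 ≤ n → n ≢ h → 1 ≤ unskipLevel h n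
unskipLevel-positive h n 1≤h 1≤n n≢h with n <? h
... | yes n<h rewrite if-<ᵇ-true {u = n} {v = pred n} n<h = 1≤n
unskipLevel-positive h (suc n) 1≤h 1≤n n≢h | no n≮h
  rewrite if-<ᵇ-false {u = suc n} {v = n} (≮⇒≥ n≮h) = ≤-trans 1≤h (≤-pred (≤∧≢⇒< (≮⇒≥ n≮h) (≢-sym n≢h)))

unskipLevel-mono-< : ∀ h {p q} → p < q → p ≢ h → q ≢ h → unskipLevel h p < unskipLevel h q
unskipLevel-mono-< h {p} {q} p<q p≢h q≢h with unskipLevel h p <? unskipLevel h q
... | yes lt = lt
... | no ≮ = ⊥-elim (<⇒≱ p<q (subst₂ _≤_ (skipLevel-unskipLevel h q q≢h) (skipLevel-unskipLevel h p p≢h)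
                                            (skipLevel-mono-≤ (≮⇒≥ ≮))))
  where
  skipLevel-mono-≤ : ∀ {m n} → m ≤ n → skipLevel h m ≤ skipLevel h n
  skipLevel-mono-≤ m≤n with m≤n⇒m<n∨m≡n m≤n
  ... | inj₁ m<n  = <⇒≤ (skipLevel-mono-< h m<n)
  ... | inj₂ refl = ≤-refl

wireAt-cross : ∀ c h p → wireAt (applyStep c (cross h)) p ≡ wireAt c (swapLevel h p)
wireAt-cross c h = swapAt≗swapLevel h (wireAt c)

wireAt-fall : ∀ c h p → wireAt (applyStep c (fall h)) p ≡ wireAt c (skipLevel h p)
wireAt-fall c h p = sym (if-float (wireAt c) (p <ᵇ h))

record Valid (c : Config) : Set where
  field
    positive  : ∀ n → 1 ≤ n → 1 ≤ wireAt c n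
    unfallen  : ∀ n → 1 ≤ n → wireAt c n ∉ fallen c
    injective : ∀ m n → 1 ≤ m → 1 ≤ n → wireAt c m ≡ wireAt c n → m ≡ n

  alive : ∀ n → 1 ≤ n → Alive (fallen c) (wireAt c n)
  alive n 1≤n = positive n 1≤n , unfallen n 1≤n

open Valid

valid-init : Valid initConfig
valid-init = record { positive = λ _ 1≤n → 1≤n ; unfallen = λ _ _ () ; injective = λ _ _ _ _ eq → eq }

valid-applyStep : ∀ c s → 1 ≤ stepLevel s → Valid c → Valid (applyStep c s)
valid-applyStep c (cross h) 1≤h V = record
  { positive  = λ n 1≤n → subst (1 ≤_) (sym (wireAt-cross c h n)) (positive V _ (1≤σ n 1≤n))
  ; unfallen  = λ n 1≤n → subst (_∉ fallen c) (sym (wireAt-cross c h n)) (unfallen V _ (1≤σ n 1≤n))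
  ; injective = λ m n 1≤m 1≤n eq → begin
      m                               ≡⟨ sym (swapLevel-involutive h m) ⟩
      swapLevel h (swapLevel h m)     ≡⟨ cong (swapLevel h) (injective V _ _ (1≤σ m 1≤m) (1≤σ n 1≤n)
                                           (trans (sym (wireAt-cross c h m)) (trans eq (wireAt-cross c h n)))) ⟩
      swapLevel h (swapLevel h n)     ≡⟨ swapLevel-involutive h n ⟩
      n                               ∎
  }
  where
  open ≡-Reasoning
  1≤σ : ∀ n → 1 ≤ n → 1 ≤ swapLevel h n
  1≤σ n = swapLevel-positive h n 1≤h
valid-applyStep c (fall h) 1≤h V = record
  { positive  = λ n 1≤n → subst (1 ≤_) (sym (wireAt-fall c h n)) (positive V _ (skipLevel-positive h n 1≤n))
  ; unfallen  = λ n 1≤n → subst (_∉ fallen (applyStep c (fall h))) (sym (wireAt-fall c h n)) (survivor n 1≤n)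
  ; injective = λ m n 1≤m 1≤n eq → skipLevel-injective h
      (injective V _ _ (skipLevel-positive h m 1≤m) (skipLevel-positive h n 1≤n)
        (trans (sym (wireAt-fall c h m)) (trans eq (wireAt-fall c h n))))
  }
  where
  survivor : ∀ n → 1 ≤ n → wireAt c (skipLevel h n) ∉ wireAt c h ∷ fallen c
  survivor n 1≤n (here eq) = skipLevel-≢ h n (injective V _ _ (skipLevel-positive h n 1≤n) 1≤h eq)
  survivor n 1≤n (there ∈fallen) = unfallen V _ (skipLevel-positive h n 1≤n) ∈fallen

valid-run : ∀ c D → WellFormed D → Valid c → Valid (run c D)
valid-run c []      []         V = V
valid-run c (s ∷ D) (1≤s ∷ wf) V = valid-run (applyStep c s) D wf (valid-applyStep c s 1≤s V)

valid-configAfter : ∀ D → WellFormed D → ∀ i → Valid (configAfter D i)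
valid-configAfter D wf i = valid-run initConfig (take i D) (take⁺ i wf) valid-init

stepAt-wellFormed : ∀ D → WellFormed D → ∀ {i s} → stepAt D i ≡ just s → 1 ≤ stepLevel s
stepAt-wellFormed (_ ∷ _) (1≤s ∷ _)  {zero}  refl = 1≤s
stepAt-wellFormed (_ ∷ D) (_ ∷ wf)   {suc i} eq   = stepAt-wellFormed D wf eq

run-take-suc : ∀ c D i {s} → stepAt D i ≡ just s → run c (take (suc i) D) ≡ applyStep (run c (take i D)) s
run-take-suc c (s ∷ D) zero    refl = refl
run-take-suc c (s ∷ D) (suc i) eq   = run-take-suc (applyStep c s) D i eq

run-take-beyond : ∀ c D i → stepAt D i ≡ nothing → run c (take (suc i) D) ≡ run c (take i D)
run-take-beyond c []      zero    _  = refl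
run-take-beyond c []      (suc i) _  = refl
run-take-beyond c (s ∷ D) (suc i) eq = run-take-beyond (applyStep c s) D i eq

configAfter-suc : ∀ D i {s} → stepAt D i ≡ just s → configAfter D (suc i) ≡ applyStep (configAfter D i) s
configAfter-suc D = run-take-suc initConfig D

configAfter-beyond : ∀ D i → stepAt D i ≡ nothing → configAfter D (suc i) ≡ configAfter D i
configAfter-beyond D = run-take-beyond initConfig D

data StepAt (D : Diagram) (i : ℕ) : Set where
  step   : ∀ s → stepAt D i ≡ just s → StepAt D i
  beyond : stepAt D i ≡ nothing → StepAt D i

stepAt? : ∀ D i → StepAt D i
stepAt? D i with stepAt D i in eq
... | just s  = step s eq
... | nothing = beyond eq

fallen-step : ∀ D i {x} → x ∈ fallen (configAfter D i) → x ∈ fallen (configAfter D (suc i))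
fallen-step D i {x} x∈ with stepAt? D i
... | beyond eq        = subst (λ c → x ∈ fallen c) (sym (configAfter-beyond D i eq)) x∈
... | step (cross h) eq = subst (λ c → x ∈ fallen c) (sym (configAfter-suc D i eq)) x∈
... | step (fall h) eq  = subst (λ c → x ∈ fallen c) (sym (configAfter-suc D i eq)) (there x∈)

fallen-mono : ∀ D {i j x} → i ≤ j → x ∈ fallen (configAfter D i) → x ∈ fallen (configAfter D j)
fallen-mono D {j = zero}  z≤n x∈ = x∈
fallen-mono D {j = suc j} i≤1+j x∈ with m≤n⇒m<n∨m≡n i≤1+j
... | inj₂ refl  = x∈
... | inj₁ i<1+j = fallen-step D j (fallen-mono D (m<1+n⇒m≤n i<1+j) x∈)

≈ₚ-sym : ∀ {π ρ} → π ≈ₚ ρ → ρ ≈ₚ π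
≈ₚ-sym π≈ρ h 1≤h = sym (π≈ρ h 1≤h)

≈ₚ-trans : ∀ {π ρ τ} → π ≈ₚ ρ → ρ ≈ₚ τ → π ≈ₚ τ
≈ₚ-trans π≈ρ ρ≈τ h 1≤h = trans (π≈ρ h 1≤h) (ρ≈τ h 1≤h)

nextPerm : Step → (ℕ → ℕ) → ℕ → ℕ
nextPerm (cross h) π n = π (swapLevel h n)
nextPerm (fall h)  π n = if π h <ᵇ π (skipLevel h n) then pred (π (skipLevel h n)) else π (skipLevel h n)

nextPerm-cong : ∀ s {π ρ} → 1 ≤ stepLevel s → π ≈ₚ ρ → nextPerm s π ≈ₚ nextPerm s ρ
nextPerm-cong (cross h) 1≤h π≈ρ n 1≤n = π≈ρ (swapLevel h n) (swapLevel-positive h n 1≤h 1≤n)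
nextPerm-cong (fall h)  1≤h π≈ρ n 1≤n
  rewrite π≈ρ h 1≤h | π≈ρ (skipLevel h n) (skipLevel-positive h n 1≤n) = refl

perm-applyStep : ∀ c s → 1 ≤ stepLevel s → Valid c → perm (applyStep c s) ≈ₚ nextPerm s (perm c)
perm-applyStep c (cross h) _ _ n _ = cong (suc ∘ aliveBelow (fallen c)) (wireAt-cross c h n)
perm-applyStep c (fall h) 1≤h V n 1≤n with <-cmp (wireAt c h) (wireAt c (skipLevel h n))
... | tri< x<y _ _ = begin
  suc (aliveBelow (x ∷ fallen c) (wireAt (applyStep c (fall h)) n))
    ≡⟨ cong (suc ∘ aliveBelow (x ∷ fallen c)) (wireAt-fall c h n) ⟩
  suc (aliveBelow (x ∷ fallen c) y)
    ≡⟨ aliveBelow-fall-> (fallen c) x-alive y x<y ⟩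
  aliveBelow (fallen c) y
    ≡⟨ sym (if-<ᵇ-true (s≤s (aliveBelow-mono-< (fallen c) x-alive x<y))) ⟩
  nextPerm (fall h) (perm c) n ∎
  where
  open ≡-Reasoning
  x y : ℕ
  x = wireAt c h
  y = wireAt c (skipLevel h n)
  x-alive : Alive (fallen c) x
  x-alive = alive V h 1≤h
... | tri≈ _ x≡y _ = ⊥-elim (skipLevel-≢ h n (sym (injective V _ _ 1≤h (skipLevel-positive h n 1≤n) x≡y)))
... | tri> _ _ y<x = begin
  suc (aliveBelow (x ∷ fallen c) (wireAt (applyStep c (fall h)) n))
    ≡⟨ cong (suc ∘ aliveBelow (x ∷ fallen c)) (wireAt-fall c h n) ⟩
  suc (aliveBelow (x ∷ fallen c) y)
    ≡⟨ cong suc (aliveBelow-fall-≤ (fallen c) (alive V h 1≤h) y (<⇒≤ y<x)) ⟩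
  suc (aliveBelow (fallen c) y)
    ≡⟨ sym (if-<ᵇ-false (<⇒≤ (s≤s (aliveBelow-mono-< (fallen c) y-alive y<x)))) ⟩
  nextPerm (fall h) (perm c) n ∎
  where
  open ≡-Reasoning
  x y : ℕ
  x = wireAt c h
  y = wireAt c (skipLevel h n)
  y-alive : Alive (fallen c) y
  y-alive = alive V (skipLevel h n) (skipLevel-positive h n 1≤n)

permAfter-suc : ∀ D → WellFormed D → ∀ i {s} → stepAt D i ≡ just s → permAfter D (suc i) ≈ₚ nextPerm s (permAfter D i)
permAfter-suc D wf i {s} eq n 1≤n =
  trans (cong (λ c → perm c n) (configAfter-suc D i eq))
        (perm-applyStep (configAfter D i) s (stepAt-wellFormed D wf eq) (valid-configAfter D wf i) n 1≤n)

permAfter-zero : ∀ D → IsId (permAfter D 0)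
permAfter-zero D (suc n) _ = cong suc (aliveBelow-initial n)

permAfter-suc-cong : ∀ D E → WellFormed D → WellFormed E → ∀ {i j s} → stepAt D i ≡ just s → stepAt E j ≡ just s →
                     permAfter D i ≈ₚ permAfter E j → permAfter D (suc i) ≈ₚ permAfter E (suc j)
permAfter-suc-cong D E wfD wfE {i} {j} {s} stepD stepE same =
  ≈ₚ-trans (permAfter-suc D wfD i stepD)
    (≈ₚ-trans (nextPerm-cong s (stepAt-wellFormed D wfD stepD) same) (≈ₚ-sym (permAfter-suc E wfE j stepE)))

module SamePerm {c₁ c₂ : Config} (V₁ : Valid c₁) (V₂ : Valid c₂) (π₁≈π₂ : perm c₁ ≈ₚ perm c₂) where

  wire-< : ∀ {p q} → 1 ≤ p → 1 ≤ q → wireAt c₁ p < wireAt c₁ q → wireAt c₂ p < wireAt c₂ q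
  wire-< {p} {q} 1≤p 1≤q lt = aliveBelow-cancel-< (fallen c₂) (alive V₂ q 1≤q)
    (≤-pred (subst₂ _<_ (π₁≈π₂ p 1≤p) (π₁≈π₂ q 1≤q) (s≤s (aliveBelow-mono-< (fallen c₁) (alive V₁ p 1≤p) lt))))

  between-fallen : ∀ {p q} → 1 ≤ p → 1 ≤ q → wireAt c₁ p < wireAt c₁ q →
                   (∀ c → wireAt c₁ p < c → c < wireAt c₁ q → c ∈ fallen c₁) →
                   (∀ c → wireAt c₂ p < c → c < wireAt c₂ q → c ∈ fallen c₂)
  between-fallen {p} {q} 1≤p 1≤q lt between = consecutive⇒between-fallen (fallen c₂) (alive V₂ p 1≤p)
    (suc-injective (trans (sym (π₁≈π₂ q 1≤q))
      (trans (cong suc (between-fallen⇒consecutive (fallen c₁) (alive V₁ p 1≤p) (wireAt c₁ q) lt between))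
             (cong suc (π₁≈π₂ p 1≤p)))))

Above : Config → ℕ → ℕ → Set
Above c y x = ∃[ p ] ∃[ q ] (1 ≤ p × p < q × wireAt c p ≡ y × wireAt c q ≡ x)

stepMeets-levels : ∀ {f s x y l} → 1 ≤ stepLevel s → StepMeets f s x y l →
  ∃[ p ] ∃[ q ] (1 ≤ p × p < q × f p ≡ x × f q ≡ y × (∀ g → StepMeets g s (g p) (g q) l))
stepMeets-levels {s = cross h} 1≤h (crossMeet ex ey)  =
  h , suc h , 1≤h , ≤-refl , ex , ey , λ _ → crossMeet refl refl
stepMeets-levels {s = fall h}  1≤h (fallMeet j ex ey) =
  h , h + suc j , 1≤h , m<m+n h z<s , ex , ey , λ _ → fallMeet j refl refl

stepMeets-above : ∀ c {s x y l} → 1 ≤ stepLevel s → StepMeets (wireAt c) s x y l → Above c x y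
stepMeets-above c 1≤s meet with stepMeets-levels 1≤s meet
... | p , q , 1≤p , p<q , ex , ey , _ = p , q , 1≤p , p<q , ex , ey

above-applyStep : ∀ c s {x y} → 1 ≤ stepLevel s → Above (applyStep c s) y x →
                  StepMeets (wireAt c) s x y (stepLevel s) ⊎ Above c y x
above-applyStep c (cross h) 1≤h (p , q , 1≤p , p<q , ey , ex) with (p ≟ h) ×-dec (q ≟ suc h)
... | yes (refl , refl) = inj₁ (crossMeet (trans (cong (wireAt c) (sym (swapLevel-lower h))) (before q ex))
                                          (trans (cong (wireAt c) (sym (swapLevel-upper h))) (before p ey)))
  where
  before : ∀ n {z} → wireAt (applyStep c (cross h)) n ≡ z → wireAt c (swapLevel h n) ≡ z
  before n = trans (sym (wireAt-cross c h n))
... | no not-swapped = inj₂ (swapLevel h p , swapLevel h q , swapLevel-positive h p 1≤h 1≤p ,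
                             swapLevel-mono-< h p q p<q not-swapped ,
                             trans (sym (wireAt-cross c h p)) ey , trans (sym (wireAt-cross c h q)) ex)
above-applyStep c (fall h) 1≤h (p , q , 1≤p , p<q , ey , ex) =
  inj₂ (skipLevel h p , skipLevel h q , skipLevel-positive h p 1≤p , skipLevel-mono-< h p<q ,
        trans (sym (wireAt-fall c h p)) ey , trans (sym (wireAt-fall c h q)) ex)

MetBefore : Diagram → ℕ → ℕ → ℕ → Set
MetBefore D i x y = ∃[ j ] ∃[ l ] (j < i × IntersectAt D j x y l)

metBefore-suc : ∀ {D i x y} → MetBefore D i x y → MetBefore D (suc i) x y
metBefore-suc (j , l , j<i , meet) = j , l , m<n⇒m<1+n j<i , meet

-- Wires start in increasing order, so every inversion was created by a meeting.
inversion⇒metBefore : ∀ D → WellFormed D → ∀ i {x y} → x < y → Above (configAfter D i) y x → MetBefore D i x y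
inversion⇒metBefore D wf zero x<y (p , q , _ , p<q , refl , refl) = ⊥-elim (<-asym x<y p<q)
inversion⇒metBefore D wf (suc i) {x} {y} x<y above with stepAt? D i
... | beyond eq = metBefore-suc (inversion⇒metBefore D wf i x<y (subst (λ c → Above c y x) (configAfter-beyond D i eq) above))
... | step s eq with above-applyStep (configAfter D i) s (stepAt-wellFormed D wf eq)
                      (subst (λ c → Above c y x) (configAfter-suc D i eq) above)
...   | inj₁ meet   = i , stepLevel s , ≤-refl , s , eq , inj₁ meet
...   | inj₂ above′ = metBefore-suc (inversion⇒metBefore D wf i x<y above′)

AscendingStep : Config → Step → Set
AscendingStep c s = ∀ {x y l} → StepMeets (wireAt c) s x y l → x < y

Ascending : Diagram → Set
Ascending D = ∀ i {s} → stepAt D i ≡ just s → AscendingStep (configAfter D i) s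

reduced⇒ascending : ∀ D → WellFormed D → Reduced D → Ascending D
reduced⇒ascending D wf red i {s} eq {x} {y} {l} meet with <-cmp x y
... | tri< x<y _ _ = x<y
... | tri≈ _ refl _ with stepMeets-above (configAfter D i) (stepAt-wellFormed D wf eq) meet
...   | p , q , 1≤p , p<q , ex , ex′ =
  ⊥-elim (<-irrefl (injective (valid-configAfter D wf i) p q 1≤p (≤-trans 1≤p (<⇒≤ p<q)) (trans ex (sym ex′))) p<q)
reduced⇒ascending D wf red i {s} eq {x} {y} {l} meet | tri> _ _ y<x
  with inversion⇒metBefore D wf i y<x (stepMeets-above (configAfter D i) (stepAt-wellFormed D wf eq) meet)
... | j , l′ , j<i , earlier = ⊥-elim (<-irrefl (red y x j i l′ l earlier (s , eq , inj₂ meet)) j<i)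

Resolved : Config → ℕ → ℕ → Set
Resolved c x y = x ∈ fallen c ⊎ Above c y x

resolved-by-meet : ∀ c s {x y l} → 1 ≤ stepLevel s → StepMeets (wireAt c) s x y l → Resolved (applyStep c s) x y
resolved-by-meet c (cross h) 1≤h (crossMeet ex ey) =
  inj₂ (h , suc h , 1≤h , ≤-refl ,
        trans (wireAt-cross c h h) (trans (cong (wireAt c) (swapLevel-upper h)) ey) ,
        trans (wireAt-cross c h (suc h)) (trans (cong (wireAt c) (swapLevel-lower h)) ex))
resolved-by-meet c (fall h) _ (fallMeet j ex _) = inj₁ (here (sym ex))

resolved-applyStep : ∀ c s {x y} → 1 ≤ stepLevel s → AscendingStep c s → x < y →
                     Resolved c x y → Resolved (applyStep c s) x y
resolved-applyStep c (cross h) _ _ _ (inj₁ x∈) = inj₁ x∈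
resolved-applyStep c (fall h)  _ _ _ (inj₁ x∈) = inj₁ (there x∈)
resolved-applyStep c (cross h) 1≤h asc x<y (inj₂ (p , q , 1≤p , p<q , ey , ex)) with (p ≟ h) ×-dec (q ≟ suc h)
... | yes (refl , refl) = ⊥-elim (<-asym x<y (asc (crossMeet ey ex)))
... | no not-swapped =
  inj₂ (swapLevel h p , swapLevel h q , swapLevel-positive h p 1≤h 1≤p , swapLevel-mono-< h p q p<q not-swapped ,
        trans (wireAt-cross c h (swapLevel h p)) (trans (cong (wireAt c) (swapLevel-involutive h p)) ey) ,
        trans (wireAt-cross c h (swapLevel h q)) (trans (cong (wireAt c) (swapLevel-involutive h q)) ex))
resolved-applyStep c (fall h) 1≤h asc x<y (inj₂ (p , q , 1≤p , p<q , ey , ex)) with p ≟ h | q ≟ h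
... | yes refl | _ = ⊥-elim (<-asym x<y (asc (fallMeet (q ∸ suc p) ey (trans (cong (wireAt c) q-split) ex))))
  where
  q-split : p + suc (q ∸ suc p) ≡ q
  q-split = trans (+-suc p (q ∸ suc p)) (m+[n∸m]≡n p<q)
... | no _ | yes refl = inj₁ (here (sym ex))
... | no p≢h | no q≢h =
  inj₂ (unskipLevel h p , unskipLevel h q , unskipLevel-positive h p 1≤h 1≤p p≢h , unskipLevel-mono-< h p<q p≢h q≢h ,
        trans (wireAt-fall c h (unskipLevel h p)) (trans (cong (wireAt c) (skipLevel-unskipLevel h p p≢h)) ey) ,
        trans (wireAt-fall c h (unskipLevel h q)) (trans (cong (wireAt c) (skipLevel-unskipLevel h q q≢h)) ex))

intersect-sym : ∀ {D i x y l} → IntersectAt D i x y l → IntersectAt D i y x l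
intersect-sym (s , eq , inj₁ meet) = s , eq , inj₂ meet
intersect-sym (s , eq , inj₂ meet) = s , eq , inj₁ meet

intersect-oriented : ∀ {D} → Ascending D → ∀ {i x y l} → x < y → IntersectAt D i x y l →
                     ∃[ s ] (stepAt D i ≡ just s × StepMeets (wireAt (configAfter D i)) s x y l)
intersect-oriented asc x<y (s , eq , inj₁ meet) = s , eq , meet
intersect-oriented asc {i} x<y (s , eq , inj₂ meet) = ⊥-elim (<-asym x<y (asc i eq meet))

intersect-< : ∀ {D} → Ascending D → ∀ {i x y l} → IntersectAt D i x y l → x < y ⊎ y < x
intersect-< asc {i} (s , eq , inj₁ meet) = inj₁ (asc i eq meet)
intersect-< asc {i} (s , eq , inj₂ meet) = inj₂ (asc i eq meet)

resolved-after-meet : ∀ D → WellFormed D → Ascending D → ∀ {j x y l} → x < y → IntersectAt D j x y l →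
                      ∀ i → j < i → Resolved (configAfter D i) x y
resolved-after-meet D wf asc {x = x} {y} x<y I (suc i) j<1+i with m<1+n⇒m<n∨m≡n j<1+i
... | inj₂ refl with intersect-oriented asc x<y I
...   | s , eq , meet = subst (λ c → Resolved c x y) (sym (configAfter-suc D i eq))
                              (resolved-by-meet (configAfter D i) s (stepAt-wellFormed D wf eq) meet)
resolved-after-meet D wf asc {x = x} {y} x<y I (suc i) j<1+i | inj₁ j<i with stepAt? D i
... | beyond eq = subst (λ c → Resolved c x y) (sym (configAfter-beyond D i eq))
                        (resolved-after-meet D wf asc x<y I i j<i)
... | step s eq = subst (λ c → Resolved c x y) (sym (configAfter-suc D i eq))
                        (resolved-applyStep (configAfter D i) s (stepAt-wellFormed D wf eq) (asc i eq) x<y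
                          (resolved-after-meet D wf asc x<y I i j<i))

no-remeet-< : ∀ D → WellFormed D → Ascending D → ∀ {i j x y l m} → x < y →
              IntersectAt D i x y l → IntersectAt D j x y m → ¬ i < j
no-remeet-< D wf asc {j = j} x<y Iᵢ Iⱼ i<j with intersect-oriented asc x<y Iⱼ
... | s , eq , meet with stepMeets-above (configAfter D j) (stepAt-wellFormed D wf eq) meet
                       | resolved-after-meet D wf asc x<y Iᵢ j i<j
...   | hx , hy , 1≤hx , hx<hy , ex , ey | inj₁ x∈ = unfallen V hx 1≤hx (subst (_∈ fallen (configAfter D j)) (sym ex) x∈)
  where
  V : Valid (configAfter D j)
  V = valid-configAfter D wf j
...   | hx , hy , 1≤hx , hx<hy , ex , ey | inj₂ (p , q , 1≤p , p<q , ey′ , ex′) =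
  <-asym hx<hy (subst₂ _<_ (injective V p hy 1≤p 1≤hy (trans ey′ (sym ey)))
                           (injective V q hx (≤-trans 1≤p (<⇒≤ p<q)) 1≤hx (trans ex′ (sym ex))) p<q)
  where
  V : Valid (configAfter D j)
  V = valid-configAfter D wf j
  1≤hy : 1 ≤ hy
  1≤hy = ≤-trans 1≤hx (<⇒≤ hx<hy)

no-remeet : ∀ D → WellFormed D → Ascending D → ∀ {i j x y l m} →
            IntersectAt D i x y l → IntersectAt D j x y m → ¬ i < j
no-remeet D wf asc {i} {j} Iᵢ Iⱼ with intersect-< asc Iᵢ
... | inj₁ x<y = no-remeet-< D wf asc x<y Iᵢ Iⱼ
... | inj₂ y<x = no-remeet-< D wf asc y<x (intersect-sym {D} {i} Iᵢ) (intersect-sym {D} {j} Iⱼ)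

ascending⇒reduced : ∀ D → WellFormed D → Ascending D → Reduced D
ascending⇒reduced D wf asc a b i j l m Iᵢ Iⱼ with <-cmp i j
... | tri< i<j _ _ = ⊥-elim (no-remeet D wf asc Iᵢ Iⱼ i<j)
... | tri≈ _ i≡j _ = i≡j
... | tri> _ _ j<i = ⊥-elim (no-remeet D wf asc Iⱼ Iᵢ j<i)

fallsAt⇒fallen : ∀ D {i x} → FallsAt D i x → x ∈ fallen (configAfter D (suc i))
fallsAt⇒fallen D {i} {x} (h , eq , ex) = subst (λ c → x ∈ fallen c) (sym (configAfter-suc D i eq)) (here (sym ex))

metBefore⇒meetsNotAtFall : ∀ D {i x y} → x ∉ fallen (configAfter D i) → MetBefore D i x y → MeetsNotAtFall D x y
metBefore⇒meetsNotAtFall D x∉ (j , l , j<i , I) = j , l , I , λ falls → x∉ (fallen-mono D j<i (fallsAt⇒fallen D falls))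

-- Each inversion comes from an earlier meeting, which was not the fall of the wire still present at level n+1.
inversions⇒violatesS2 : ∀ W → WellFormed W → ∀ i n ms →
  All (λ m → m < n × wireAt (configAfter W i) (suc n) < wireAt (configAfter W i) (suc m)) ms →
  Unique ms → ViolatesS2 (length ms) W
inversions⇒violatesS2 W wf i n ms inversions unique =
  w (suc n) , map (w ∘ suc) ms , length-map (w ∘ suc) ms ,
  Unique.map⁺ (λ eq → suc-injective (injective V _ _ (s≤s z≤n) (s≤s z≤n) eq)) unique ,
  All.map⁺ (All.map meets inversions)
  where
  V : Valid (configAfter W i)
  V = valid-configAfter W wf i
  w : ℕ → ℕ
  w = wireAt (configAfter W i)
  meets : ∀ {m} → m < n × w (suc n) < w (suc m) → w (suc n) < w (suc m) × MeetsNotAtFall W (w (suc n)) (w (suc m))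
  meets (m<n , lt) = lt , metBefore⇒meetsNotAtFall W (unfallen V (suc n) (s≤s z≤n))
                            (inversion⇒metBefore W wf i lt (suc _ , suc n , s≤s z≤n , s≤s m<n , refl , refl))

All-latest : ∀ {A : Set} {P : A → ℕ → Set} {x xs} → All (λ y → ∃ (P y)) (x ∷ xs) →
             ∃[ y ] ∃[ t ] (P y t × All (λ z → ∃[ s ] (s ≤ t × P z s)) (x ∷ xs))
All-latest ((i , p) ∷ []) = _ , i , p , (i , ≤-refl , p) ∷ []
All-latest ((i , p) ∷ rest@(_ ∷ _)) with All-latest rest
... | y , t , q , latest with i ≤? t
...   | yes i≤t = y , t , q , (i , i≤t , p) ∷ latest
...   | no i≰t  = _ , i , p , (i , ≤-refl , p) ∷ All.map (λ (s , s≤t , r) → s , ≤-trans s≤t (<⇒≤ (≰⇒> i≰t)) , r) latest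

All-preimage : ∀ {A B : Set} {P : A → Set} {f : A → B} {bs} →
               All (λ b → ∃[ a ] (P a × f a ≡ b)) bs → ∃[ as ] (map f as ≡ bs × All P as)
All-preimage [] = [] , refl , []
All-preimage ((a , pa , refl) ∷ rest) with All-preimage rest
... | as , refl , pas = a ∷ as , refl , pa ∷ pas

record SimpleModel (k : ℕ) (Q : Diagram) (i : ℕ) (s : Step) : Set where
  field
    W        : Diagram
    j        : ℕ
    simple   : Simple k W
    stepW    : stepAt W j ≡ just s
    samePerm : permAfter Q i ≈ₚ permAfter W j

LocallySimple : ℕ → Diagram → Set
LocallySimple k Q = ∀ i {s} → stepAt Q i ≡ just s → SimpleModel k Q i s

module LocallySimpleDiagram {k Q} (wfQ : WellFormed Q) (local : LocallySimple k Q) where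

  validQ : ∀ i → Valid (configAfter Q i)
  validQ = valid-configAfter Q wfQ

  wireAfter : ℕ → ℕ → ℕ
  wireAfter t = wireAt (configAfter Q t)

  module Model {i s} (stepQ : stepAt Q i ≡ just s) where
    open SimpleModel (local i stepQ) public

    wfW : WellFormed W
    wfW = proj₁ simple

    ascendingW : Ascending W
    ascendingW = reduced⇒ascending W wfW (proj₁ (proj₂ simple))

    samePerm-suc : permAfter Q (suc i) ≈ₚ permAfter W (suc j)
    samePerm-suc = permAfter-suc-cong Q W wfQ wfW stepQ stepW samePerm

    module Q→W = SamePerm (validQ i) (valid-configAfter W wfW j) samePerm
    module W→Q = SamePerm (valid-configAfter W wfW j) (validQ i) (≈ₚ-sym samePerm)
    module Q→W-after = SamePerm (validQ (suc i)) (valid-configAfter W wfW (suc j)) samePerm-suc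

  ascending : Ascending Q
  ascending i stepQ meet with stepMeets-levels (stepAt-wellFormed Q wfQ stepQ) meet
  ... | p , q , 1≤p , p<q , ex , ey , relabel =
    subst₂ _<_ ex ey (W→Q.wire-< 1≤p (≤-trans 1≤p (<⇒≤ p<q)) (ascendingW j stepW (relabel _)))
    where open Model stepQ

  reduced : Reduced Q
  reduced = ascending⇒reduced Q wfQ ascending

  noViolatesS1 : ¬ ViolatesS1 k Q
  noViolatesS1 (a , b , i , l , a<b , I , l≢k , between) with intersect-oriented ascending a<b I
  ... | s , stepQ , meet with stepMeets-levels (stepAt-wellFormed Q wfQ stepQ) meet
  ...   | p , q , 1≤p , p<q , refl , refl , relabel =
    proj₁ (proj₂ (proj₂ simple))
      (_ , _ , j , l , Q→W.wire-< 1≤p 1≤q a<b , (s , stepW , inj₁ (relabel _)) , l≢k ,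
       Q→W.between-fallen 1≤p 1≤q a<b between)
    where
    open Model stepQ
    1≤q : 1 ≤ q
    1≤q = ≤-trans 1≤p (<⇒≤ p<q)

  upper-survives : ∀ {t s a b l} → stepAt Q t ≡ just s → StepMeets (wireAfter t) s a b l →
                   ¬ FallsAt Q t a → wireAfter (suc t) (suc (stepLevel s)) ≡ a
  upper-survives {t} {cross h} stepQ (crossMeet ex _) _ = begin
    wireAt (configAfter Q (suc t)) (suc h)                ≡⟨ cong (λ c → wireAt c (suc h)) (configAfter-suc Q t stepQ) ⟩
    wireAt (applyStep (configAfter Q t) (cross h)) (suc h) ≡⟨ wireAt-cross (configAfter Q t) h (suc h) ⟩
    wireAt (configAfter Q t) (swapLevel h (suc h))        ≡⟨ cong (wireAt (configAfter Q t)) (swapLevel-lower h) ⟩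
    wireAt (configAfter Q t) h                            ≡⟨ ex ⟩
    _                                                     ∎
    where open ≡-Reasoning
  upper-survives {s = fall h} stepQ (fallMeet _ ex _) notFalling = ⊥-elim (notFalling (h , stepQ , ex))

  met-before⇒above : ∀ {t n a} → wireAfter (suc t) (suc n) ≡ a →
    ∀ {b} → ∃[ i ] (i ≤ t × a < b × ∃[ l ] (IntersectAt Q i a b l × ¬ FallsAt Q i a)) →
    ∃[ m ] ((m < n × wireAfter (suc t) (suc n) < wireAfter (suc t) (suc m)) × wireAfter (suc t) (suc m) ≡ b)
  met-before⇒above {t} {n} a-at (i , i≤t , a<b , l , Iᵢ , _)
    with resolved-after-meet Q wfQ ascending a<b Iᵢ (suc t) (s≤s i≤t)
  ... | inj₁ a∈ = ⊥-elim (unfallen (validQ (suc t)) (suc n) (s≤s z≤n)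
                           (subst (_∈ fallen (configAfter Q (suc t))) (sym a-at) a∈))
  ... | inj₂ (suc m , q , _ , 1+m<q , refl , wq≡a) =
    m , (≤-pred (subst (suc m <_) q≡1+n 1+m<q) , subst (_< _) (sym a-at) a<b) , refl
    where
    q≡1+n : q ≡ suc n
    q≡1+n = injective (validQ (suc t)) q (suc n) (≤-trans (s≤s z≤n) 1+m<q) (s≤s z≤n) (trans wq≡a (sym a-at))

  noViolatesS2 : 1 ≤ k → ¬ ViolatesS2 k Q
  noViolatesS2 1≤k (a , [] , len , _ , _) = <-irrefl len 1≤k
  noViolatesS2 1≤k (a , b ∷ bs , len , unique , meetings)
    with All-latest (All.map (λ (a<b , i , rest) → i , a<b , rest) meetings)
  ... | _ , t , (a<b′ , _ , I , notFalling) , latest with intersect-oriented ascending a<b′ I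
  ... | s , stepQ , meet
    with All-preimage (All.map (met-before⇒above (upper-survives stepQ meet notFalling)) latest)
  ...   | ms , ms↦bs , inversionsQ =
    proj₂ (proj₂ (proj₂ simple)) (subst (λ n → ViolatesS2 n W) length-ms violationW)
    where
    open Model stepQ
    length-ms : length ms ≡ k
    length-ms = trans (sym (length-map _ ms)) (trans (cong length ms↦bs) len)
    violationW : ViolatesS2 (length ms) W
    violationW = inversions⇒violatesS2 W wfW (suc j) (stepLevel s) ms
      (All.map (λ (m<n , lt) → m<n , Q→W-after.wire-< (s≤s z≤n) (s≤s z≤n) lt) inversionsQ)
      (Unique.map⁻ (subst Unique (sym ms↦bs) unique))

pieceAt : List Piece → ℕ → Maybe Piece
pieceAt []       _       = nothing
pieceAt (P ∷ _)  zero    = just P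
pieceAt (_ ∷ Ps) (suc i) = pieceAt Ps i

stepAt-concat : ∀ Ps i {s} → stepAt (concatPieces Ps) i ≡ just s → ∃[ P ] (pieceAt Ps i ≡ just P × pstep P ≡ s)
stepAt-concat (P ∷ _)  zero    refl = P , refl , refl
stepAt-concat (_ ∷ Ps) (suc i) eq   = stepAt-concat Ps i eq

stepAt-concat⁺ : ∀ Ps i {P} → pieceAt Ps i ≡ just P → stepAt (concatPieces Ps) i ≡ just (pstep P)
stepAt-concat⁺ (_ ∷ _)  zero    refl = refl
stepAt-concat⁺ (_ ∷ Ps) (suc i) eq   = stepAt-concat⁺ Ps i eq

pieceAt-All : ∀ {R : Piece → Set} Ps i {P} → All R Ps → pieceAt Ps i ≡ just P → R P
pieceAt-All (_ ∷ _)  zero    (r ∷ _)  refl = r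
pieceAt-All (_ ∷ Ps) (suc i) (_ ∷ rs) eq   = pieceAt-All Ps i rs eq

pieceAt-pred : ∀ Ps i {P′} → pieceAt Ps (suc i) ≡ just P′ → ∃[ P ] (pieceAt Ps i ≡ just P)
pieceAt-pred (P ∷ _)  zero    _  = P , refl
pieceAt-pred (_ ∷ Ps) (suc i) eq = pieceAt-pred Ps i eq

pieceAt-chained : ∀ Ps i {P P′} → Chained Ps → pieceAt Ps i ≡ just P → pieceAt Ps (suc i) ≡ just P′ → π⁺ P ≈ₚ π⁻ P′
pieceAt-chained (_ ∷ _ ∷ _)  zero    (link , _) refl refl = link
pieceAt-chained (_ ∷ P ∷ Ps) (suc i) (_ , chain) eq eq′  = pieceAt-chained (P ∷ Ps) i chain eq eq′
pieceAt-chained (_ ∷ [])     (suc i) _ () _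

pieceAt-start : ∀ Ps {P} → StartsAtId Ps → pieceAt Ps 0 ≡ just P → IsId (π⁻ P)
pieceAt-start (_ ∷ _) start refl = start

concat-wellFormed : ∀ {k Ps} → All (SimplePiece k) Ps → WellFormed (concatPieces Ps)
concat-wellFormed []                                       = []
concat-wellFormed ((W , j , (wfW , _) , (stepW , _)) ∷ rest) = stepAt-wellFormed W wfW stepW ∷ concat-wellFormed rest

module Concatenation {k Ps} (simplePieces : All (SimplePiece k) Ps) (chained : Chained Ps) (starts : StartsAtId Ps) where

  Q : Diagram
  Q = concatPieces Ps

  wellFormed : WellFormed Q
  wellFormed = concat-wellFormed simplePieces

  perm-before : ∀ i {P} → pieceAt Ps i ≡ just P → permAfter Q i ≈ₚ π⁻ P
  perm-before zero    at0 = ≈ₚ-trans (permAfter-zero Q) (≈ₚ-sym (pieceAt-start Ps starts at0))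
  perm-before (suc i) at′ with pieceAt-pred Ps i at′
  ... | P , at with pieceAt-All Ps i simplePieces at
  ...   | W , j , (wfW , _) , (stepW , pre , post) =
    ≈ₚ-trans (permAfter-suc-cong Q W wellFormed wfW (stepAt-concat⁺ Ps i at) stepW
               (≈ₚ-trans (perm-before i at) pre))
      (≈ₚ-trans (≈ₚ-sym post) (pieceAt-chained Ps i chained at at′))

  locallySimple : LocallySimple k Q
  locallySimple i stepQ with stepAt-concat Ps i stepQ
  ... | P , at , refl with pieceAt-All Ps i simplePieces at
  ...   | W , j , simpleW , (stepW , pre , _) = record
    { W = W ; j = j ; simple = simpleW ; stepW = stepW ; samePerm = ≈ₚ-trans (perm-before i at) pre }

proposition4p14 : (k : ℕ) → 1 ≤ k → (Ps : List Piece) →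
    All (SimplePiece k) Ps → Chained Ps → StartsAtId Ps →
    Reduced (concatPieces Ps) × Simple k (concatPieces Ps)
proposition4p14 k 1≤k Ps simplePieces chained starts =
  reduced , wellFormed , reduced , noViolatesS1 , noViolatesS2 1≤k
  where
  open Concatenation simplePieces chained starts
  open LocallySimpleDiagram wellFormed locallySimple
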